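{- For all BCCSP processes $p_1,p_2$: $p_1\le_I^{b\supseteq}p_2$ if and only if $\mathit{BGO}_I(p_1)\subseteq\mathit{BGO}_I(p_2)$.
   Context: BCCSP processes over a set $\mathit{Act}$: $p ::= \mathbf{0}\mid ap\mid p+q$; transitions $ap\xrightarrow{a}p$, and $p\xrightarrow{a}p'$ implies $p+q\xrightarrow{a}p'$ and $q+p\xrightarrow{a}p'$. $I(p)=\{a\mid\exists p'.\,p\xrightarrow{a}p'\}$. Branching observations: finite trees $\langle A,S\rangle$ with $A\subseteq\mathit{Act}$ and $S$ a finite set of pairs $(a,b)$, $b$ a branching observation. $\mathit{BGO}_I(p)$ is the inductively defined set of all $\langle I(p),S\rangle$ with $S$ a finite subset of $\{(a,b)\mid p\xrightarrow{a}p',\ b\in\mathit{BGO}_I(p')\}$. Order on observations: $b\le_I^{\supseteq}b'$ iff $b=\langle A_1,S_1\rangle$, $b'=\langle A_2,S_2\rangle$, $A_1\supseteq A_2$, and there is an index set $J$ with $S_1=\{(a_i,b_i)\mid i\in J\}$, $S_2=\{(a_i,b'_i)\mid i\in J\}$ and $b_i\le_I^{\supseteq}b'_i$ for all $i\in J$. $p_1\le_I^{b\supseteq}p_2$ iff for every $b\in\mathit{BGO}_I(p_1)$ there exists $b'\in\mathit{BGO}_I(p_2)$ with $b\le_I^{\supseteq}b'$. -}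

module Defs where

open import Data.List using (List; map)
open import Data.List.Membership.Propositional using (_∈_)
open import Data.Product using (Σ; ∃; _×_; _,_)
open import Function.Bundles using (_⇔_)

data Proc (Act : Set) : Set where
  𝟎   : Proc Act
  _·_ : Act → Proc Act → Proc Act
  _⊕_ : Proc Act → Proc Act → Proc Act

infixr 6 _·_
infixl 5 _⊕_

data _—[_]→_ {Act : Set} : Proc Act → Act → Proc Act → Set where
  pre  : ∀ {a p} → (a · p) —[ a ]→ p
  sumˡ : ∀ {p q a p'} → p —[ a ]→ p' → (p ⊕ q) —[ a ]→ p'
  sumʳ : ∀ {p q a p'} → p —[ a ]→ p' → (q ⊕ p) —[ a ]→ p'

_∈I_ : {Act : Set} → Act → Proc Act → Set
a ∈I p = ∃ λ p' → p —[ a ]→ p'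

-- Finite sets are represented by lists,
-- read as the set of their elements (order and repetitions irrelevant).
data Obs (Act : Set) : Set where
  ⟨_,_⟩ : List Act → List (Act × Obs Act) → Obs Act

data _≈_ {Act : Set} : Obs Act → Obs Act → Set where
  ≈-mk : ∀ {A₁ S₁ A₂ S₂} →
         (∀ a → (a ∈ A₁) ⇔ (a ∈ A₂)) →
         (∀ {a b} → (a , b) ∈ S₁ → ∃ λ b' → ((a , b') ∈ S₂) × (b ≈ b')) →
         (∀ {a b} → (a , b) ∈ S₂ → ∃ λ b' → ((a , b') ∈ S₁) × (b ≈ b')) →
         ⟨ A₁ , S₁ ⟩ ≈ ⟨ A₂ , S₂ ⟩

SetEq : {Act : Set} → List (Act × Obs Act) → List (Act × Obs Act) → Set
SetEq S T =
  (∀ {a b} → (a , b) ∈ S → ∃ λ b' → ((a , b') ∈ T) × (b ≈ b')) ×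
  (∀ {a b} → (a , b) ∈ T → ∃ λ b' → ((a , b') ∈ S) × (b ≈ b'))

data _∈BGO_ {Act : Set} : Obs Act → Proc Act → Set where
  bgo : ∀ {A S p} →
        (∀ a → (a ∈ A) ⇔ (a ∈I p)) →
        (∀ {a b} → (a , b) ∈ S → ∃ λ p' → (p —[ a ]→ p') × (b ∈BGO p')) →
        ⟨ A , S ⟩ ∈BGO p

_⊆BGO_ : {Act : Set} → Proc Act → Proc Act → Set
p₁ ⊆BGO p₂ = ∀ b → b ∈BGO p₁ → b ∈BGO p₂

-- Index sets J are represented by (finite) lists of triples (a_i , b_i , b'_i).
fstPairs : {Act : Set} → List (Act × Obs Act × Obs Act) → List (Act × Obs Act)
fstPairs = map (λ { (a , b , b') → (a , b) })

sndPairs : {Act : Set} → List (Act × Obs Act × Obs Act) → List (Act × Obs Act)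
sndPairs = map (λ { (a , b , b') → (a , b') })

data _≤I⊇_ {Act : Set} : Obs Act → Obs Act → Set where
  ≤-mk : ∀ {A₁ S₁ A₂ S₂} →
         (∀ {a} → a ∈ A₂ → a ∈ A₁) →
         (J : List (Act × Obs Act × Obs Act)) →
         SetEq S₁ (fstPairs J) →
         SetEq S₂ (sndPairs J) →
         (∀ {a b b'} → (a , b , b') ∈ J → b ≤I⊇ b') →
         ⟨ A₁ , S₁ ⟩ ≤I⊇ ⟨ A₂ , S₂ ⟩

_≤Ib⊇_ : {Act : Set} → Proc Act → Proc Act → Set
p₁ ≤Ib⊇ p₂ = ∀ b → b ∈BGO p₁ → ∃ λ b' → (b' ∈BGO p₂) × (b ≤I⊇ b')

-- For ⇐, take b' = b: the order on observations is reflexive.  For ⇒, the full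
-- observation of p₁, which records every transition down to full observations of
-- the successors, lies in BGO(p₁), so it is below some b' ∈ BGO(p₂).  Being
-- saturated (each action it lists has a branch), it must then itself lie in
-- BGO(p₂): its branches are matched by branches of b', which are transitions of
-- p₂, so its action set is no larger than I(p₂).  Finally every b ∈ BGO(p₁) is a
-- pruning of the full observation of p₁, and BGO(p₂) is closed under pruning.
module Submission where

open import Defs
open import Function.Bundles using (_⇔_; mk⇔; Equivalence)
open import Function.Construct.Identity using (⇔-id)
open import Function.Construct.Composition using (_⇔-∘_)
open import Function.Construct.Symmetry using (⇔-sym)
open import Data.List using (List; []; _∷_; _++_)
open import Data.List.Relation.Unary.Any using (here; there)
open import Data.List.Membership.Propositional using (_∈_)
open import Data.List.Membership.Propositional.Properties using (∈-++⁻; ∈-++⁺ˡ; ∈-++⁺ʳ; ∈-map⁻; ∈-map⁺)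
open import Data.Product using (∃; _×_; _,_)
open import Data.Sum using (inj₁; inj₂)
open import Relation.Binary.PropositionalEquality using (_≡_; refl; cong; sym; subst)

open Equivalence using (from)

module _ {Act : Set} where

  _⊆≈_ : List (Act × Obs Act) → List (Act × Obs Act) → Set
  S ⊆≈ T = ∀ {a b} → (a , b) ∈ S → ∃ λ b' → ((a , b') ∈ T) × (b ≈ b')

  mutual
    ≈-refl : (x : Obs Act) → x ≈ x
    ≈-refl ⟨ A , S ⟩ = ≈-mk (λ a → ⇔-id (a ∈ A)) (⊆≈-refl S) (⊆≈-refl S)

    ⊆≈-refl : (S : List (Act × Obs Act)) → S ⊆≈ S
    ⊆≈-refl ((a , c) ∷ S) (here refl) = c , here refl , ≈-refl c
    ⊆≈-refl (_ ∷ S) (there m) with ⊆≈-refl S m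
    ... | b' , m' , b≈b' = b' , there m' , b≈b'

  ≈-trans : {x y z : Obs Act} → x ≈ y → y ≈ z → x ≈ z
  ≈-trans (≈-mk A l r) (≈-mk A' l' r') = ≈-mk (λ a → A' a ⇔-∘ A a)
    (λ m → let (_ , m' , e) = l m ; (b'' , m'' , e') = l' m' in b'' , m'' , ≈-trans e e')
    (λ m → let (_ , m' , e) = r' m ; (b'' , m'' , e') = r m' in b'' , m'' , ≈-trans e e')

  ⊆≈-trans : {S T U : List (Act × Obs Act)} → S ⊆≈ T → T ⊆≈ U → S ⊆≈ U
  ⊆≈-trans S⊆T T⊆U m with S⊆T m
  ... | _ , m' , e with T⊆U m'
  ... | b'' , m'' , e' = b'' , m'' , ≈-trans e e'

  diagonal : List (Act × Obs Act) → List (Act × Obs Act × Obs Act)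
  diagonal [] = []
  diagonal ((a , c) ∷ S) = (a , c , c) ∷ diagonal S

  fstPairs-diagonal : (S : List (Act × Obs Act)) → fstPairs (diagonal S) ≡ S
  fstPairs-diagonal [] = refl
  fstPairs-diagonal (ac ∷ S) = cong (ac ∷_) (fstPairs-diagonal S)

  sndPairs-diagonal : (S : List (Act × Obs Act)) → sndPairs (diagonal S) ≡ S
  sndPairs-diagonal [] = refl
  sndPairs-diagonal (ac ∷ S) = cong (ac ∷_) (sndPairs-diagonal S)

  SetEq-refl : (S : List (Act × Obs Act)) → SetEq S S
  SetEq-refl S = ⊆≈-refl S , ⊆≈-refl S

  mutual
    ≤I⊇-refl : (x : Obs Act) → x ≤I⊇ x
    ≤I⊇-refl ⟨ A , S ⟩ = ≤-mk (λ a∈A → a∈A) (diagonal S)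
      (subst (SetEq S) (sym (fstPairs-diagonal S)) (SetEq-refl S))
      (subst (SetEq S) (sym (sndPairs-diagonal S)) (SetEq-refl S))
      (≤I⊇-refl-diagonal S)

    ≤I⊇-refl-diagonal : (S : List (Act × Obs Act)) →
                        ∀ {a b b'} → (a , b , b') ∈ diagonal S → b ≤I⊇ b'
    ≤I⊇-refl-diagonal ((a , c) ∷ S) (here refl) = ≤I⊇-refl c
    ≤I⊇-refl-diagonal (_ ∷ S) (there m) = ≤I⊇-refl-diagonal S m

  ≤I⊇-resp-≈ : {x y z w : Obs Act} → x ≈ y → z ≈ w → y ≤I⊇ z → x ≤I⊇ w
  ≤I⊇-resp-≈ (≈-mk A₁ l₁ r₁) (≈-mk A₃ l₃ r₃) (≤-mk A₂⊆A₁ J (f₁ , g₁) (f₂ , g₂) J≤) =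
    ≤-mk (λ {a} m → from (A₁ a) (A₂⊆A₁ (from (A₃ a) m))) J
      (⊆≈-trans l₁ f₁ , ⊆≈-trans g₁ r₁)
      (⊆≈-trans r₃ f₂ , ⊆≈-trans g₂ l₃)
      J≤

  ≤I⊇-branch : ∀ {A₁ S₁ A₂ S₂} → ⟨ A₁ , S₁ ⟩ ≤I⊇ ⟨ A₂ , S₂ ⟩ →
               ∀ {a c} → (a , c) ∈ S₁ → ∃ λ d → ((a , d) ∈ S₂) × (c ≤I⊇ d)
  ≤I⊇-branch (≤-mk _ J (f₁ , _) (_ , g₂) J≤) m with f₁ m
  ... | _ , m₁ , c≈d₁ with ∈-map⁻ _ m₁
  ... | _ , mJ , refl with g₂ (∈-map⁺ (λ { (a , b , b') → (a , b') }) mJ)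
  ... | d , m₂ , d₂≈d = d , m₂ , ≤I⊇-resp-≈ c≈d₁ d₂≈d (J≤ mJ)

  data Saturated : Obs Act → Set where
    saturated : ∀ {A S} → (∀ {a} → a ∈ A → ∃ λ c → (a , c) ∈ S) →
                (∀ {a c} → (a , c) ∈ S → Saturated c) → Saturated ⟨ A , S ⟩

  ∈BGO-≤I⊇-saturated : ∀ {x y q} → Saturated x → x ≤I⊇ y → y ∈BGO q → x ∈BGO q
  ∈BGO-≤I⊇-saturated {q = q} (saturated branchOf sat) x≤y@(≤-mk A₂⊆A₁ _ _ _ _) (bgo A₂≡I S₂⊆) =
    bgo (λ a → mk⇔ (λ a∈A₁ → let (c , m) = branchOf a∈A₁ ; (q' , t , _) = branch m in q' , t)
                   (λ a∈I → A₂⊆A₁ (from (A₂≡I a) a∈I)))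
        branch
    where
    branch : ∀ {a c} → (a , c) ∈ _ → ∃ λ q' → (q —[ a ]→ q') × (c ∈BGO q')
    branch m with ≤I⊇-branch x≤y m
    ... | d , md , c≤d with S₂⊆ md
    ... | q' , t , d∈ = q' , t , ∈BGO-≤I⊇-saturated (sat m) c≤d d∈

  initials : Proc Act → List Act
  initials 𝟎 = []
  initials (a · p) = a ∷ []
  initials (p ⊕ q) = initials p ++ initials q

  mutual
    full : Proc Act → Obs Act
    full p = ⟨ initials p , fullBranches p ⟩

    fullBranches : Proc Act → List (Act × Obs Act)
    fullBranches 𝟎 = []
    fullBranches (a · p) = (a , full p) ∷ []
    fullBranches (p ⊕ q) = fullBranches p ++ fullBranches q

  initials-sound : ∀ p {a} → a ∈ initials p → a ∈I p
  initials-sound (a · p) (here refl) = p , pre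
  initials-sound (p ⊕ q) m with ∈-++⁻ (initials p) m
  ... | inj₁ m' = let (p' , t) = initials-sound p m' in p' , sumˡ t
  ... | inj₂ m' = let (q' , t) = initials-sound q m' in q' , sumʳ t

  initials-complete : ∀ {p a p'} → p —[ a ]→ p' → a ∈ initials p
  initials-complete pre = here refl
  initials-complete (sumˡ t) = ∈-++⁺ˡ (initials-complete t)
  initials-complete (sumʳ {q = q} t) = ∈-++⁺ʳ (initials q) (initials-complete t)

  initials⇔I : ∀ p a → (a ∈ initials p) ⇔ (a ∈I p)
  initials⇔I p a = mk⇔ (initials-sound p) (λ (_ , t) → initials-complete t)

  fullBranches-complete : ∀ {p a p'} → p —[ a ]→ p' → (a , full p') ∈ fullBranches p
  fullBranches-complete pre = here refl
  fullBranches-complete (sumˡ t) = ∈-++⁺ˡ (fullBranches-complete t)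
  fullBranches-complete (sumʳ {q = q} t) = ∈-++⁺ʳ (fullBranches q) (fullBranches-complete t)

  mutual
    full-saturated : ∀ p → Saturated (full p)
    full-saturated p = saturated
      (λ m → let (p' , t) = initials-sound p m in full p' , fullBranches-complete t)
      (fullBranches-saturated p)

    fullBranches-saturated : ∀ p {a c} → (a , c) ∈ fullBranches p → Saturated c
    fullBranches-saturated (a · p) (here refl) = full-saturated p
    fullBranches-saturated (p ⊕ q) m with ∈-++⁻ (fullBranches p) m
    ... | inj₁ m' = fullBranches-saturated p m'
    ... | inj₂ m' = fullBranches-saturated q m'

  mutual
    full-∈BGO : ∀ p → full p ∈BGO p
    full-∈BGO p = bgo (initials⇔I p) (fullBranches-∈BGO p)

    fullBranches-∈BGO : ∀ p {a c} → (a , c) ∈ fullBranches p →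
                        ∃ λ p' → (p —[ a ]→ p') × (c ∈BGO p')
    fullBranches-∈BGO (a · p) (here refl) = p , pre , full-∈BGO p
    fullBranches-∈BGO (p ⊕ q) m with ∈-++⁻ (fullBranches p) m
    ... | inj₁ m' = let (p' , t , c∈) = fullBranches-∈BGO p m' in p' , sumˡ t , c∈
    ... | inj₂ m' = let (q' , t , c∈) = fullBranches-∈BGO q m' in q' , sumʳ t , c∈

  data _⊑_ : Obs Act → Obs Act → Set where
    ⊑-mk : ∀ {A S A' S'} → (∀ a → (a ∈ A) ⇔ (a ∈ A')) →
           (∀ {a c} → (a , c) ∈ S → ∃ λ c' → ((a , c') ∈ S') × (c ⊑ c')) →
           ⟨ A , S ⟩ ⊑ ⟨ A' , S' ⟩

  ∈BGO⇒⊑full : ∀ {b p} → b ∈BGO p → b ⊑ full p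
  ∈BGO⇒⊑full {p = p} (bgo A≡I S⊆) =
    ⊑-mk (λ a → ⇔-sym (initials⇔I p a) ⇔-∘ A≡I a)
         (λ m → let (p' , t , b∈) = S⊆ m in full p' , fullBranches-complete t , ∈BGO⇒⊑full b∈)

  ∈BGO-⊑-closed : ∀ {b x q} → b ⊑ x → x ∈BGO q → b ∈BGO q
  ∈BGO-⊑-closed (⊑-mk A≡A' S⊑) (bgo A'≡I S'⊆) =
    bgo (λ a → A'≡I a ⇔-∘ A≡A' a)
        (λ m → let (_ , m' , c⊑c') = S⊑ m ; (q' , t , c'∈) = S'⊆ m' in q' , t , ∈BGO-⊑-closed c⊑c' c'∈)

proposition4p47 : {Act : Set} (p₁ p₂ : Proc Act) → (p₁ ≤Ib⊇ p₂) ⇔ (p₁ ⊆BGO p₂)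
proposition4p47 p₁ p₂ = mk⇔ ≤Ib⊇⇒⊆BGO (λ H b b∈ → b , H b b∈ , ≤I⊇-refl b)
  where
  ≤Ib⊇⇒⊆BGO : p₁ ≤Ib⊇ p₂ → p₁ ⊆BGO p₂
  ≤Ib⊇⇒⊆BGO H b b∈ =
    let (b' , b'∈ , full≤b') = H (full p₁) (full-∈BGO p₁)
        full∈ = ∈BGO-≤I⊇-saturated (full-saturated p₁) full≤b' b'∈
    in ∈BGO-⊑-closed (∈BGO⇒⊑full b∈) full∈
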